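{- Let $A$ be an $\mathsf{EGL}$-formula, $t$ a justification term and $c$ a justification constant (so that $c:(A\rightarrow(t:A\rightarrow A))$ is available by Iterated Axiom Necessitation). Then the formula $F(p)=c\cdot t:(p\rightarrow A)$ has the fixed point $t:A$ in $\mathsf{EGL}_{\mathcal{TCS}}$, i.e. $\mathsf{EGL}_{\mathcal{TCS}}\vdash c\cdot t:(t:A\rightarrow A)\leftrightarrow t:A$.
   Context: $\mathsf{EGL}$ is the justification logic with terms built from justification variables and constants by binary $\cdot$, $+$ and unary $!$; formulas $A::= p\mid\bot\mid\neg A\mid A\wedge A\mid A\vee A\mid A\rightarrow A\mid t:A$; axioms: all propositional tautologies, $s:A\rightarrow(s+t):A$, $s:A\rightarrow(t+s):A$, $s:(A\rightarrow B)\rightarrow(t:A\rightarrow(s\cdot t):B)$, $t:A\rightarrow !t:t:A$, and the explicit Löb axiom $s:(t:A\rightarrow A)\rightarrow t:A$; rules Modus Ponens and Iterated Axiom Necessitation: $\vdash c_{i_n}:\dots:c_{i_1}:B$ for any axiom instance $B$, arbitrary constants, $n\ge 1$. The subscript $\mathcal{TCS}$ (total constant specification) means Iterated Axiom Necessitation is unrestricted. -}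

module Defs where

open import Data.Nat using (ℕ)
open import Data.Bool using (Bool; true; false; not; _∧_; _∨_)
open import Relation.Binary.PropositionalEquality using (_≡_)

data Tm : Set where
  var   : ℕ → Tm
  const : ℕ → Tm
  _·_   : Tm → Tm → Tm
  _⊕_   : Tm → Tm → Tm
  !_    : Tm → Tm

data Fm : Set where
  atom : ℕ → Fm
  ⊥'   : Fm
  ¬'_  : Fm → Fm
  _∧'_ : Fm → Fm → Fm
  _∨'_ : Fm → Fm → Fm
  _⇒_  : Fm → Fm → Fm
  _∶_  : Tm → Fm → Fm

infixr 6 _⇒_
infixr 9 _∶_

_⇔'_ : Fm → Fm → Fm
A ⇔' B = (A ⇒ B) ∧' (B ⇒ A)

-- Propositional evaluation: atoms and justification assertions t:A are
-- treated as propositional atoms (valuation v on atoms, w on t:A).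
eval : (ℕ → Bool) → (Tm → Fm → Bool) → Fm → Bool
eval v w (atom n) = v n
eval v w ⊥' = false
eval v w (¬' A) = not (eval v w A)
eval v w (A ∧' B) = eval v w A ∧ eval v w B
eval v w (A ∨' B) = eval v w A ∨ eval v w B
eval v w (A ⇒ B) = not (eval v w A) ∨ eval v w B
eval v w (t ∶ A) = w t A

Taut : Fm → Set
Taut A = ∀ (v : ℕ → Bool) (w : Tm → Fm → Bool) → eval v w A ≡ true

data Axiom : Fm → Set where
  ax-taut : ∀ {A} → Taut A → Axiom A
  ax-sumˡ : ∀ s t A → Axiom (s ∶ A ⇒ (s ⊕ t) ∶ A)
  ax-sumʳ : ∀ s t A → Axiom (s ∶ A ⇒ (t ⊕ s) ∶ A)
  ax-app  : ∀ s t A B → Axiom (s ∶ (A ⇒ B) ⇒ (t ∶ A ⇒ (s · t) ∶ B))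
  ax-pc   : ∀ t A → Axiom (t ∶ A ⇒ (! t) ∶ t ∶ A)
  ax-löb  : ∀ s t A → Axiom (s ∶ (t ∶ A ⇒ A) ⇒ t ∶ A)

-- Iterated Axiom Necessitation (total CS): c_{i_n} : … : c_{i_1} : B
-- for any axiom instance B, arbitrary constants, n ≥ 1.
data IAN : Fm → Set where
  ian-base : ∀ i {B} → Axiom B → IAN (const i ∶ B)
  ian-step : ∀ i {B} → IAN B → IAN (const i ∶ B)

data EGL⊢_ : Fm → Set where
  axiom : ∀ {A} → Axiom A → EGL⊢ A
  mp    : ∀ {A B} → EGL⊢ (A ⇒ B) → EGL⊢ A → EGL⊢ B
  iax   : ∀ {A} → IAN A → EGL⊢ A

module Submission where

-- Both directions are one-step consequences of the axioms:
--   (→) c·t:(t:A → A) → t:A is literally an instance of the explicit Löb axiom.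
--   (←) A → (t:A → A) is a tautology, so the constant c justifies it by axiom
--       necessitation; the application axiom then turns any evidence t for A
--       into evidence c·t for t:A → A.

open import Defs
open import Data.Nat using (ℕ)
open import Data.Bool using (true; false)
open import Relation.Binary.PropositionalEquality using (refl)

weakening-taut : ∀ A B → Taut (A ⇒ (B ⇒ A))
weakening-taut A B v w with eval v w A | eval v w B
... | true  | true  = refl
... | true  | false = refl
... | false | _     = refl

⇔-intro-taut : ∀ X Y → Taut ((X ⇒ Y) ⇒ ((Y ⇒ X) ⇒ (X ⇔' Y)))
⇔-intro-taut X Y v w with eval v w X | eval v w Y
... | true  | true  = refl
... | true  | false = refl
... | false | true  = refl
... | false | false = refl

⇔-intro : ∀ {X Y} → EGL⊢ (X ⇒ Y) → EGL⊢ (Y ⇒ X) → EGL⊢ (X ⇔' Y)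
⇔-intro {X} {Y} X⇒Y Y⇒X = mp (mp (axiom (ax-taut (⇔-intro-taut X Y))) X⇒Y) Y⇒X

lift-taut : ∀ {A B} (i : ℕ) (t : Tm) → Taut (A ⇒ B) →
  EGL⊢ (t ∶ A ⇒ (const i · t) ∶ B)
lift-taut {A} {B} i t A⇒B =
  mp (axiom (ax-app (const i) t A B)) (iax (ian-base i (ax-taut A⇒B)))

lemma7 : ∀ (A : Fm) (t : Tm) (i : ℕ) →
    EGL⊢ (((const i · t) ∶ (t ∶ A ⇒ A)) ⇔' (t ∶ A))
lemma7 A t i = ⇔-intro löb-instance (lift-taut i t (weakening-taut A (t ∶ A)))
  where
    löb-instance : EGL⊢ ((const i · t) ∶ (t ∶ A ⇒ A) ⇒ t ∶ A)
    löb-instance = axiom (ax-löb (const i · t) t A)
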